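{- Let $(\mathcal{G},\mathcal{I})$ be a $k$-exchange system with $n=|\mathcal{G}|$ and $f:2^{\mathcal{G}}\to\mathbb{R}_{+}$ a monotone submodular function. For any $\epsilon\in(0,1)$, the Non-Oblivious Local Search algorithm described in the context makes at most $O(n^3\epsilon^{ -2})$ improvements (i.e., applies at most that many $k$-replacements before terminating).
   Context: An independence system $(\mathcal{G},\mathcal{I})$: finite ground set $\mathcal{G}$, nonempty downward-closed $\mathcal{I}\subseteq 2^{\mathcal{G}}$. It is a $k$-exchange system ($k\ge1$ an integer) if for all $A,B\in\mathcal{I}$ there is a collection $\{Y_e\subseteq B\setminus A: e\in A\setminus B\}$ with $|Y_e|\le k$, each $x\in B\setminus A$ in at most $k$ sets $Y_e$, and $(B\setminus\bigcup_{e\in C}Y_e)\cup C\in\mathcal{I}$ for all $C\subseteq A\setminus B$. Given a current solution $S\in\mathcal{I}$, a $k$-replacement is a pair $(A,B)$ with $B\subseteq S$, $A\subseteq\mathcal{G}\setminus(S\setminus B)$, $|A|\le k$, $|B|\le k^2-k+1$, $(S\setminus B)\cup A\in\mathcal{I}$. Algorithm: let $S_{init}=\{e^*\}$ where $e^*$ maximizes $f(\{e\})$; $\delta=(1+\frac{k+3}{2\epsilon})^{ -1}$, $\alpha=f(S_{init})\delta/n$; start with $S=S_{init}$ and an arbitrary total order $\prec$ on $\mathcal{G}$. In each iteration: list $S=\{s_1,\dots,s_m\}$ in $\prec$-order, $S_i=\{s_1,\dots,s_i\}$, set $w(s_i)=\lfloor (f(S_{i-1}\cup\{s_i\})-f(S_{i-1}))/\alpha\rfloor\alpha$.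 For each $k$-replacement $(A,B)$, list $A=\{a_1,\dots,a_r\}$ in $\prec$-order, $A_i=\{a_1,\dots,a_i\}$, set $w_{(A,B)}(a_i)=\lfloor (f((S\setminus B)\cup A_{i-1}\cup\{a_i\})-f((S\setminus B)\cup A_{i-1}))/\alpha\rfloor\alpha$. If $\sum_{a\in A}w_{(A,B)}(a)^2>\sum_{b\in B}w(b)^2$ (an improvement), replace $\prec$ by the order $\prec'$ in which every element of $S\setminus B$ precedes every element of $A$ and all other pairs are ordered as in $\prec$, replace $S$ by $(S\setminus B)\cup A$, and start the next iteration. If no $k$-replacement satisfies the condition, return $S$. -}

module Defs where

open import Level using (0ℓ)
open import Data.Nat as ℕ using (ℕ; zero; suc; _∸_)
open import Data.Integer as ℤ using (ℤ; +_; -[1+_])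
open import Data.Bool using (Bool; true; false; _∧_; if_then_else_)
open import Data.Product using (Σ; ∃; _×_; _,_)
open import Data.Fin using (Fin; zero; suc)
open import Data.Fin.Properties using (any?)
open import Data.Fin.Subset
  using (Subset; _∈_; _⊆_; _∪_; _∩_; _─_; ∁; ∣_∣; ⁅_⁆)
open import Data.Fin.Subset.Properties using (_∈?_)
open import Data.Vec using (tabulate)
open import Relation.Nullary using (¬_; does)
open import Relation.Nullary.Decidable using (_×-dec_)
open import Relation.Binary using (Rel; IsTotalOrder)
open import Relation.Binary.PropositionalEquality using (_≡_; _≢_)
open import Algebra.Structures using (IsCommutativeRing)
open import Function.Definitions using (Injective)

-- The paper uses ℝ; stdlib has no reals, so we
-- quantify over an arbitrary ordered field equipped with a floor
-- function (ℝ is one such).  The inverse is total (x ⁻¹ is only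
-- specified for x ≢ 0#).

record OrderedField : Set₁ where
  infixl 6 _+_
  infixl 7 _*_
  infix 4 _≤_
  field
    Carrier  : Set
    _+_ _*_  : Carrier → Carrier → Carrier
    -_       : Carrier → Carrier
    0# 1#    : Carrier
    _⁻¹      : Carrier → Carrier
    _≤_      : Rel Carrier 0ℓ
    isCommutativeRing : IsCommutativeRing _≡_ _+_ _*_ -_ 0# 1#
    0≢1        : 0# ≢ 1#
    ⁻¹-inverse : ∀ x → x ≢ 0# → x * (x ⁻¹) ≡ 1#
    ≤-isTotalOrder : IsTotalOrder _≡_ _≤_
    +-mono-≤  : ∀ {x y} z → x ≤ y → x + z ≤ y + z
    *-nonneg  : ∀ {x y} → 0# ≤ x → 0# ≤ y → 0# ≤ x * y

  infix 4 _<_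
  _<_ : Rel Carrier 0ℓ
  x < y = x ≤ y × x ≢ y

  _-_ : Carrier → Carrier → Carrier
  x - y = x + (- y)

  fromℕ : ℕ → Carrier
  fromℕ zero    = 0#
  fromℕ (suc m) = 1# + fromℕ m

  fromℤ : ℤ → Carrier
  fromℤ (+ m)      = fromℕ m
  fromℤ -[1+ m ]   = - fromℕ (suc m)

record FloorField : Set₁ where
  field
    ordF : OrderedField
  open OrderedField ordF
  field
    ⌊_⌋         : Carrier → ℤ
    floor-lower : ∀ x → fromℤ ⌊ x ⌋ ≤ x
    floor-upper : ∀ x → x < fromℤ ⌊ x ⌋ + 1#

module _ {n : ℕ} where

  IsIndependenceSystem : (Subset n → Set) → Set
  IsIndependenceSystem I =
    (∃ λ A → I A) × (∀ {A B} → B ⊆ A → I A → I B)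

  bigUnion : (Fin n → Subset n) → Subset n → Subset n
  bigUnion Y C = tabulate (λ x → does (any? (λ e → (e ∈? C) ×-dec (x ∈? Y e))))

  holders : (Fin n → Subset n) → Subset n → Fin n → Subset n
  holders Y D x = tabulate (λ e → does (e ∈? D) ∧ does (x ∈? Y e))

  IsKExchange : ℕ → (Subset n → Set) → Set
  IsKExchange k I =
    ∀ A B → I A → I B →
    Σ (Fin n → Subset n) λ Y →
        (∀ e → e ∈ (A ─ B) → (Y e ⊆ (B ─ A)) × (∣ Y e ∣ ℕ.≤ k))
      × (∀ x → x ∈ (B ─ A) → ∣ holders Y (A ─ B) x ∣ ℕ.≤ k)
      × (∀ C → C ⊆ (A ─ B) → I ((B ─ bigUnion Y C) ∪ C))

  IsKReplacement : ℕ → (Subset n → Set) → Subset n → Subset n → Subset n → Set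
  IsKReplacement k I S A B =
      B ⊆ S
    × A ⊆ ∁ (S ─ B)
    × ∣ A ∣ ℕ.≤ k
    × ∣ B ∣ ℕ.≤ (k ℕ.* k ∸ k) ℕ.+ 1
    × I ((S ─ B) ∪ A)

  -- total orders ≺ on Fin n are represented by injective ranks:
  -- x ≺ y iff rk x < rk y.  prefix rk S x = { y ∈ S : y ≺ x }.
  prefix : (Fin n → ℕ) → Subset n → Fin n → Subset n
  prefix rk S x = tabulate (λ y → does (y ∈? S) ∧ does (rk y ℕ.<? rk x))

module Setup (R : FloorField) where
  open FloorField R
  open OrderedField ordF

  Σ[_] : ∀ {m} → (Fin m → Carrier) → Carrier
  Σ[_] {zero}  g = 0#
  Σ[_] {suc m} g = g zero + Σ[_] (λ i → g (suc i))

  module _ {n : ℕ} where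

    sumOver : Subset n → (Fin n → Carrier) → Carrier
    sumOver S g = Σ[_] (λ x → if does (x ∈? S) then g x else 0#)

    NonNegative Monotone Submodular : (Subset n → Carrier) → Set
    NonNegative f = ∀ A → 0# ≤ f A
    Monotone    f = ∀ A B → A ⊆ B → f A ≤ f B
    Submodular  f = ∀ A B → f (A ∪ B) + f (A ∩ B) ≤ f A + f B

    quantize : Carrier → Carrier → Carrier
    quantize α x = fromℤ ⌊ x * (α ⁻¹) ⌋ * α

    -- δ = (1 + (k+3)/(2ε))⁻¹ ,  α = f(S_init) δ / n
    alpha : ℕ → Carrier → (Subset n → Carrier) → Fin n → Carrier
    alpha k ε f e* =
      f ⁅ e* ⁆ * ((1# + fromℕ (k ℕ.+ 3) * ((fromℕ 2 * ε) ⁻¹)) ⁻¹) * (fromℕ n ⁻¹)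

    weight : Carrier → (Subset n → Carrier) → (Fin n → ℕ) → Subset n → Fin n → Carrier
    weight α f rk S s =
      quantize α (f (prefix rk S s ∪ ⁅ s ⁆) - f (prefix rk S s))

    weightAB : Carrier → (Subset n → Carrier) → (Fin n → ℕ) →
               Subset n → Subset n → Subset n → Fin n → Carrier
    weightAB α f rk S A B a =
      quantize α (f (((S ─ B) ∪ prefix rk A a) ∪ ⁅ a ⁆)
                  - f ((S ─ B) ∪ prefix rk A a))

    sq : Carrier → Carrier
    sq x = x * x

    IsReorder : (Fin n → ℕ) → (Fin n → ℕ) → Subset n → Subset n → Subset n → Set
    IsReorder rk rk' S A B =
        Injective _≡_ _≡_ rk'
      × (∀ x y → x ∈ (S ─ B) → y ∈ A → rk' x ℕ.< rk' y)
      × (∀ x y → x ∈ (S ─ B) → y ∈ (S ─ B) → rk x ℕ.< rk y → rk' x ℕ.< rk' y)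
      × (∀ x y → x ∈ A → y ∈ A → rk x ℕ.< rk y → rk' x ℕ.< rk' y)

    State : Set
    State = Subset n × (Fin n → ℕ)

    Step : ℕ → (Subset n → Set) → (f : Subset n → Carrier) → Carrier →
           State → State → Set
    Step k I f α (S , rk) (S' , rk') =
      Σ (Subset n) λ A → Σ (Subset n) λ B →
          IsKReplacement k I S A B
        × sumOver B (λ b → sq (weight α f rk S b))
            < sumOver A (λ a → sq (weightAB α f rk S A B a))
        × S' ≡ (S ─ B) ∪ A
        × IsReorder rk rk' S A B

    data Run (k : ℕ) (I : Subset n → Set) (f : Subset n → Carrier) (α : Carrier)
             : ℕ → State → State → Set where
      done : ∀ {s} → Run k I f α zero s s
      step : ∀ {t s s' u} → Step k I f α s s' → Run k I f α t s' u →
             Run k I f α (suc t) s u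

-- Call ⌊f(x | P)/α⌋ the level of x over P, so that the weight w(x) of
-- x ∈ S is α times its level over its ≺-predecessors in S, and let Φ(S, ≺) be the sum of the
-- squared levels of the elements of S, a natural number.  After an improvement (A, B) every
-- element of S ∖ B keeps only some of its predecessors, and every a ∈ A gets at most the
-- predecessors (S ∖ B) ∪ {a' ∈ A : a' ≺ a} used for w_(A,B)(a); by submodularity no level
-- drops, so Φ grows by at least the positive integer Σ_A (w_(A,B)/α)² − Σ_B (w/α)².  As a level
-- times α is at most f({e*}), Φ α² ≤ n f({e*})², and α = f({e*}) δ / n turns this into
-- t ≤ n³ / δ² ≤ n³ (k+5)² / ε².
module Submission where

open import Defs

open import Level using (0ℓ)
open import Function using (_∘_)
open import Function.Definitions using (Injective)
open import Data.Empty using (⊥-elim)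
open import Data.Product using (∃; _×_; _,_; proj₁; proj₂)
open import Data.Sum using (inj₁; inj₂)
open import Data.Bool using (true; _∧_; if_then_else_)
open import Data.Nat as ℕ using (ℕ; zero; suc)
import Data.Nat.Properties as ℕ
import Data.Integer as ℤ
open import Data.Fin using (Fin; zero; suc)
open import Data.Fin.Subset using (Subset; _∈_; _∉_; _⊆_; _∪_; _∩_; _─_; ⁅_⁆)
open import Data.Fin.Subset.Properties
  using (_∈?_; x∈p∪q⁻; x∈p∪q⁺; x∈p∩q⁺; p⊆p∪q; p─q⊆p; x∈p∧x∉q⇒x∈p─q; x∈∁p⇒x∉p)
open import Data.Vec.Properties using (lookup∘tabulate; lookup⇒[]=; []=⇒lookup)
open import Relation.Nullary using (¬_; yes; no; Dec; does)
open import Relation.Nullary.Decidable using (dec-true)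
open import Relation.Binary using (IsTotalOrder; Poset; tri<; tri≈; tri>)
open import Relation.Binary.PropositionalEquality
  using (_≡_; _≢_; refl; sym; trans; cong; cong₂; subst; subst₂; module ≡-Reasoning)
import Relation.Binary.Reasoning.PartialOrder as PosetReasoning
open import Algebra.Bundles using (CommutativeRing)
open import Algebra.Structures using (IsCommutativeRing)
import Algebra.Properties.Ring as RingProperties
import Algebra.Solver.CommutativeMonoid as CommutativeMonoidSolver
open import Algebra.Properties.CommutativeMonoid.Sum ℕ.+-0-commutativeMonoid
  using (sum; sum-cong-≗; ∑-distrib-+)

module OrderedFieldProperties (F : OrderedField) where
  open OrderedField F renaming (+-mono-≤ to +-monoˡ-≤)
  open IsCommutativeRing isCommutativeRing
    using (+-comm; +-assoc; +-identityˡ; +-identityʳ; *-comm; *-assoc;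
           *-identityˡ; *-identityʳ; distribʳ; zeroˡ; zeroʳ; -‿inverseˡ; -‿inverseʳ)

  commutativeRing : CommutativeRing 0ℓ 0ℓ
  commutativeRing = record { isCommutativeRing = isCommutativeRing }

  open RingProperties (CommutativeRing.ring commutativeRing)
    using (-‿distribˡ-*; -‿distribʳ-*; -‿involutive; -1*x≈-x; -‿anti-homo-+)

  module +-Solver = CommutativeMonoidSolver (CommutativeRing.+-commutativeMonoid commutativeRing)
  module *-Solver = CommutativeMonoidSolver (CommutativeRing.*-commutativeMonoid commutativeRing)

  poset : Poset 0ℓ 0ℓ 0ℓ
  poset = record { isPartialOrder = IsTotalOrder.isPartialOrder ≤-isTotalOrder }

  module ≤-Reasoning = PosetReasoning poset

  open Poset poset public using ()
    renaming (refl to ≤-refl; reflexive to ≤-reflexive; trans to ≤-trans; antisym to ≤-antisym)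
  open IsTotalOrder ≤-isTotalOrder public using () renaming (total to ≤-total)

  +-monoʳ-≤ : ∀ {x y} z → x ≤ y → z + x ≤ z + y
  +-monoʳ-≤ {x} {y} z x≤y = subst₂ _≤_ (+-comm x z) (+-comm y z) (+-monoˡ-≤ z x≤y)

  +-mono-≤ : ∀ {a b c d} → a ≤ b → c ≤ d → a + c ≤ b + d
  +-mono-≤ {b = b} {c = c} a≤b c≤d = ≤-trans (+-monoˡ-≤ c a≤b) (+-monoʳ-≤ b c≤d)

  x-y+y≡x : ∀ x y → x - y + y ≡ x
  x-y+y≡x x y = trans (+-assoc x (- y) y) (trans (cong (x +_) (-‿inverseˡ y)) (+-identityʳ x))

  [xy]²≡x²y² : ∀ x y → (x * y) * (x * y) ≡ (x * x) * (y * y)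
  [xy]²≡x²y² = solve 2 (λ x y → (x ⊕ y) ⊕ (x ⊕ y) ⊜ (x ⊕ x) ⊕ (y ⊕ y)) refl
    where open *-Solver

  x≤y⇒0≤y-x : ∀ {x y} → x ≤ y → 0# ≤ y - x
  x≤y⇒0≤y-x {x} x≤y = subst (_≤ _) (-‿inverseʳ x) (+-monoˡ-≤ (- x) x≤y)

  0≤y-x⇒x≤y : ∀ {x y} → 0# ≤ y - x → x ≤ y
  0≤y-x⇒x≤y {x} {y} 0≤y-x = subst₂ _≤_ (+-identityˡ x) (x-y+y≡x y x) (+-monoˡ-≤ x 0≤y-x)

  x+y≤z+w⇒x-w≤z-y : ∀ {x y z w} → x + y ≤ z + w → x - w ≤ z - y
  x+y≤z+w⇒x-w≤z-y {x} {y} {z} {w} x+y≤z+w = 0≤y-x⇒x≤y (subst (0# ≤_) eq (x≤y⇒0≤y-x x+y≤z+w))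
    where
    rearrange : ∀ z w x' y' → (z + w) + (x' + y') ≡ (z + y') + (x' + w)
    rearrange = solve 4 (λ z w x' y' → (z ⊕ w) ⊕ (x' ⊕ y') ⊜ (z ⊕ y') ⊕ (x' ⊕ w)) refl
      where open +-Solver
    eq : (z + w) - (x + y) ≡ (z - y) - (x - w)
    eq = begin
      (z + w) + - (x + y)        ≡⟨ cong ((z + w) +_) (trans (-‿anti-homo-+ x y) (+-comm (- y) (- x))) ⟩
      (z + w) + (- x + - y)      ≡⟨ rearrange z w (- x) (- y) ⟩
      (z + - y) + (- x + w)      ≡⟨ cong (λ v → (z + - y) + (- x + v)) (sym (-‿involutive w)) ⟩
      (z + - y) + (- x + - - w)  ≡⟨ cong ((z + - y) +_) (trans (+-comm (- x) (- - w))
                                                          (sym (-‿anti-homo-+ x (- w)))) ⟩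
      (z + - y) + - (x + - w)    ∎
      where open ≡-Reasoning

  *-monoˡ-≤ : ∀ {x y} z → 0# ≤ z → x ≤ y → x * z ≤ y * z
  *-monoˡ-≤ {x} {y} z 0≤z x≤y = 0≤y-x⇒x≤y (subst (0# ≤_) (distribˡ-minus z y x) (*-nonneg (x≤y⇒0≤y-x x≤y) 0≤z))
    where
    distribˡ-minus : ∀ z y x → (y - x) * z ≡ (y * z) - (x * z)
    distribˡ-minus z y x = trans (distribʳ z y (- x)) (cong (y * z +_) (sym (-‿distribˡ-* x z)))

  *-monoʳ-≤ : ∀ {x y} z → 0# ≤ z → x ≤ y → z * x ≤ z * y
  *-monoʳ-≤ {x} {y} z 0≤z x≤y = subst₂ _≤_ (*-comm x z) (*-comm y z) (*-monoˡ-≤ z 0≤z x≤y)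

  *-self-mono-≤ : ∀ {x y} → 0# ≤ x → x ≤ y → x * x ≤ y * y
  *-self-mono-≤ {x} {y} 0≤x x≤y = ≤-trans (*-monoˡ-≤ x 0≤x x≤y) (*-monoʳ-≤ y (≤-trans 0≤x x≤y) x≤y)

  x*a²≤y⇒x≤y*u² : ∀ {x y a u} → 0# ≤ u → a * u ≡ 1# → x * (a * a) ≤ y → x ≤ y * (u * u)
  x*a²≤y⇒x≤y*u² {x} {y} {a} {u} 0≤u au≡1 x*a²≤y = subst (_≤ y * (u * u)) x*a²*u²≡x
    (*-monoˡ-≤ (u * u) (*-nonneg 0≤u 0≤u) x*a²≤y)
    where
    regroup : ∀ x a u → x * (a * a) * (u * u) ≡ x * ((a * u) * (a * u))
    regroup = solve 3 (λ x a u → (x ⊕ (a ⊕ a)) ⊕ (u ⊕ u) ⊜ x ⊕ ((a ⊕ u) ⊕ (a ⊕ u))) refl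
      where open *-Solver
    x*a²*u²≡x : x * (a * a) * (u * u) ≡ x
    x*a²*u²≡x = trans (regroup x a u)
      (trans (cong (λ v → x * (v * v)) au≡1) (trans (cong (x *_) (*-identityʳ 1#)) (*-identityʳ x)))

  0≤1 : 0# ≤ 1#
  0≤1 with ≤-total 0# 1#
  ... | inj₁ 0≤1 = 0≤1
  ... | inj₂ 1≤0 = subst (0# ≤_) (trans (-1*x≈-x (- 1#)) (-‿involutive 1#)) (*-nonneg 0≤-1 0≤-1)
    where
    0≤-1 : 0# ≤ - 1#
    0≤-1 = subst (0# ≤_) (+-identityˡ (- 1#)) (x≤y⇒0≤y-x 1≤0)

  1≰0 : ¬ 1# ≤ 0#
  1≰0 1≤0 = 0≢1 (≤-antisym 0≤1 1≤0)

  1≤x⇒x≢0 : ∀ {x} → 1# ≤ x → x ≢ 0#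
  1≤x⇒x≢0 1≤x refl = 1≰0 1≤x

  ⁻¹-nonneg : ∀ {x} → 0# ≤ x → x ≢ 0# → 0# ≤ x ⁻¹
  ⁻¹-nonneg {x} 0≤x x≢0 with ≤-total 0# (x ⁻¹)
  ... | inj₁ 0≤x⁻¹ = 0≤x⁻¹
  ... | inj₂ x⁻¹≤0 = ⊥-elim (1≰0 (subst₂ _≤_ (+-identityˡ 1#) (-‿inverseˡ 1#) (+-monoˡ-≤ 1# 0≤-1)))
    where
    0≤-1 : 0# ≤ - 1#
    0≤-1 = subst (0# ≤_)
      (trans (sym (-‿distribʳ-* x (x ⁻¹))) (cong -_ (⁻¹-inverse x x≢0)))
      (*-nonneg 0≤x (subst (0# ≤_) (+-identityˡ _) (x≤y⇒0≤y-x x⁻¹≤0)))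

  *-≢0 : ∀ {x y} → x ≢ 0# → y ≢ 0# → x * y ≢ 0#
  *-≢0 {x} {y} x≢0 y≢0 xy≡0 = y≢0 (begin
    y                ≡⟨ sym (*-identityˡ y) ⟩
    1# * y           ≡⟨ cong (_* y) (sym (trans (*-comm (x ⁻¹) x) (⁻¹-inverse x x≢0))) ⟩
    x ⁻¹ * x * y     ≡⟨ *-assoc (x ⁻¹) x y ⟩
    x ⁻¹ * (x * y)   ≡⟨ cong (x ⁻¹ *_) xy≡0 ⟩
    x ⁻¹ * 0#        ≡⟨ zeroʳ (x ⁻¹) ⟩
    0#               ∎)
    where open ≡-Reasoning

  fromℕ-nonneg : ∀ m → 0# ≤ fromℕ m
  fromℕ-nonneg zero    = ≤-refl
  fromℕ-nonneg (suc m) = subst (_≤ fromℕ (suc m)) (+-identityˡ 0#) (+-mono-≤ 0≤1 (fromℕ-nonneg m))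

  fromℕ-+ : ∀ m n → fromℕ (m ℕ.+ n) ≡ fromℕ m + fromℕ n
  fromℕ-+ zero    n = sym (+-identityˡ (fromℕ n))
  fromℕ-+ (suc m) n = trans (cong (1# +_) (fromℕ-+ m n)) (sym (+-assoc 1# (fromℕ m) (fromℕ n)))

  fromℕ-* : ∀ m n → fromℕ (m ℕ.* n) ≡ fromℕ m * fromℕ n
  fromℕ-* zero    n = sym (zeroˡ (fromℕ n))
  fromℕ-* (suc m) n = begin
    fromℕ (n ℕ.+ m ℕ.* n)            ≡⟨ fromℕ-+ n (m ℕ.* n) ⟩
    fromℕ n + fromℕ (m ℕ.* n)        ≡⟨ cong₂ _+_ (sym (*-identityˡ (fromℕ n))) (fromℕ-* m n) ⟩
    1# * fromℕ n + fromℕ m * fromℕ n ≡⟨ sym (distribʳ (fromℕ n) 1# (fromℕ m)) ⟩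
    (1# + fromℕ m) * fromℕ n         ∎
    where open ≡-Reasoning

  fromℕ-mono-≤ : ∀ {m n} → m ℕ.≤ n → fromℕ m ≤ fromℕ n
  fromℕ-mono-≤ {m} {n} m≤n = subst₂ _≤_ (+-identityʳ (fromℕ m)) fromℕ[m+[n∸m]]≡fromℕn
    (+-monoʳ-≤ (fromℕ m) (fromℕ-nonneg (n ℕ.∸ m)))
    where
    fromℕ[m+[n∸m]]≡fromℕn : fromℕ m + fromℕ (n ℕ.∸ m) ≡ fromℕ n
    fromℕ[m+[n∸m]]≡fromℕn = trans (sym (fromℕ-+ m (n ℕ.∸ m))) (cong fromℕ (ℕ.m+[n∸m]≡n m≤n))

  1≤fromℕ-suc : ∀ m → 1# ≤ fromℕ (suc m)
  1≤fromℕ-suc m = subst (_≤ fromℕ (suc m)) (+-identityʳ 1#) (+-monoʳ-≤ 1# (fromℕ-nonneg m))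

  fromℕ-≢0 : ∀ {n} → Fin n → fromℕ n ≢ 0#
  fromℕ-≢0 {suc m} _ = 1≤x⇒x≢0 (1≤fromℕ-suc m)

  fromℕ-*-cancelʳ-< : ∀ {m n c} → 0# ≤ c → fromℕ m * c < fromℕ n * c → m ℕ.< n
  fromℕ-*-cancelʳ-< {m} {n} {c} 0≤c (mc≤nc , mc≢nc) with m ℕ.<? n
  ... | yes m<n = m<n
  ... | no m≮n = ⊥-elim (mc≢nc (≤-antisym mc≤nc (*-monoˡ-≤ c 0≤c (fromℕ-mono-≤ (ℕ.≮⇒≥ m≮n)))))

module FloorProperties (R : FloorField) where
  open FloorField R
  open OrderedField ordF
  open OrderedFieldProperties ordF
  open IsCommutativeRing isCommutativeRing using (+-comm; -‿inverseˡ)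

  floorℕ : Carrier → ℕ
  floorℕ x = ℤ.∣ ⌊ x ⌋ ∣

  ⌊⌋≡floorℕ : ∀ {x} → 0# ≤ x → fromℤ ⌊ x ⌋ ≡ fromℕ (floorℕ x)
  ⌊⌋≡floorℕ {x} 0≤x with ⌊ x ⌋ | floor-upper x
  ... | ℤ.+ m      | _             = refl
  ... | ℤ.-[1+ m ] | (x≤⌊x⌋+1 , x≢⌊x⌋+1) = ⊥-elim (x≢⌊x⌋+1 (≤-antisym x≤⌊x⌋+1 (≤-trans ⌊x⌋+1≤0 0≤x)))
    where
    ⌊x⌋+1≤0 : - fromℕ (suc m) + 1# ≤ 0#
    ⌊x⌋+1≤0 = subst (- fromℕ (suc m) + 1# ≤_) (-‿inverseˡ (fromℕ (suc m)))
                (+-monoʳ-≤ (- fromℕ (suc m)) (1≤fromℕ-suc m))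

  floorℕ-≤ : ∀ {x} → 0# ≤ x → fromℕ (floorℕ x) ≤ x
  floorℕ-≤ {x} 0≤x = subst (_≤ x) (⌊⌋≡floorℕ 0≤x) (floor-lower x)

  floorℕ-mono-≤ : ∀ {x y} → 0# ≤ x → x ≤ y → floorℕ x ℕ.≤ floorℕ y
  floorℕ-mono-≤ {x} {y} 0≤x x≤y with floorℕ x ℕ.≤? floorℕ y
  ... | yes ⌊x⌋≤⌊y⌋ = ⌊x⌋≤⌊y⌋
  ... | no ⌊x⌋≰⌊y⌋ = ⊥-elim (y≢⌊y⌋+1 (≤-antisym y≤⌊y⌋+1 ⌊y⌋+1≤y))
    where
    ⌊y⌋+1≡ : fromℤ ⌊ y ⌋ + 1# ≡ fromℕ (suc (floorℕ y))
    ⌊y⌋+1≡ = trans (cong (_+ 1#) (⌊⌋≡floorℕ (≤-trans 0≤x x≤y))) (+-comm _ 1#)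
    y≤⌊y⌋+1 : y ≤ fromℕ (suc (floorℕ y))
    y≤⌊y⌋+1 = subst (y ≤_) ⌊y⌋+1≡ (proj₁ (floor-upper y))
    y≢⌊y⌋+1 : y ≢ fromℕ (suc (floorℕ y))
    y≢⌊y⌋+1 y≡ = proj₂ (floor-upper y) (trans y≡ (sym ⌊y⌋+1≡))
    ⌊y⌋+1≤y : fromℕ (suc (floorℕ y)) ≤ y
    ⌊y⌋+1≤y = ≤-trans (fromℕ-mono-≤ (ℕ.≰⇒> ⌊x⌋≰⌊y⌋)) (≤-trans (floorℕ-≤ 0≤x) x≤y)

square : ℕ → ℕ
square m = m ℕ.* m

square-mono-≤ : ∀ {m n} → m ℕ.≤ n → square m ℕ.≤ square n
square-mono-≤ m≤n = ℕ.*-mono-≤ m≤n m≤n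

sum-mono-≤ : ∀ {m} {g h : Fin m → ℕ} → (∀ i → g i ℕ.≤ h i) → sum g ℕ.≤ sum h
sum-mono-≤ {zero}  g≤h = ℕ.z≤n
sum-mono-≤ {suc m} g≤h = ℕ.+-mono-≤ (g≤h zero) (sum-mono-≤ (λ i → g≤h (suc i)))

module _ {n : ℕ} where

  indicator : Subset n → (Fin n → ℕ) → Fin n → ℕ
  indicator S g x = if does (x ∈? S) then g x else 0

  sumℕOver : Subset n → (Fin n → ℕ) → ℕ
  sumℕOver S g = sum (indicator S g)

  sumℕOver-mono-≤ : ∀ S {g h : Fin n → ℕ} → (∀ {x} → x ∈ S → g x ℕ.≤ h x) →
                    sumℕOver S g ℕ.≤ sumℕOver S h
  sumℕOver-mono-≤ S {g} {h} g≤h = sum-mono-≤ pointwise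
    where
    pointwise : ∀ x → (if does (x ∈? S) then g x else 0) ℕ.≤ (if does (x ∈? S) then h x else 0)
    pointwise x with x ∈? S
    ... | yes x∈S = g≤h x∈S
    ... | no  _   = ℕ.z≤n

  sumℕOver-⊆-∪ : ∀ {S} P Q (g : Fin n → ℕ) → S ⊆ P ∪ Q →
                 sumℕOver S g ℕ.≤ sumℕOver P g ℕ.+ sumℕOver Q g
  sumℕOver-⊆-∪ {S} P Q g S⊆P∪Q =
    ℕ.≤-trans (sum-mono-≤ pointwise) (ℕ.≤-reflexive (∑-distrib-+ (indicator P g) (indicator Q g)))
    where
    pointwise : ∀ x → (if does (x ∈? S) then g x else 0) ℕ.≤
                      (if does (x ∈? P) then g x else 0) ℕ.+ (if does (x ∈? Q) then g x else 0)
    pointwise x with x ∈? S | x ∈? P | x ∈? Q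
    ... | no  _   | _       | _       = ℕ.z≤n
    ... | yes _   | yes _   | _       = ℕ.m≤m+n (g x) _
    ... | yes _   | no  _   | yes _   = ℕ.≤-refl
    ... | yes x∈S | no  x∉P | no  x∉Q with x∈p∪q⁻ P Q (S⊆P∪Q x∈S)
    ...   | inj₁ x∈P = ⊥-elim (x∉P x∈P)
    ...   | inj₂ x∈Q = ⊥-elim (x∉Q x∈Q)

  sumℕOver-∪ : ∀ P Q (g : Fin n → ℕ) → (∀ {x} → x ∈ P → x ∉ Q) →
               sumℕOver (P ∪ Q) g ≡ sumℕOver P g ℕ.+ sumℕOver Q g
  sumℕOver-∪ P Q g disjoint = trans (sum-cong-≗ pointwise) (∑-distrib-+ (indicator P g) (indicator Q g))
    where
    pointwise : ∀ x → (if does (x ∈? P ∪ Q) then g x else 0) ≡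
                      (if does (x ∈? P) then g x else 0) ℕ.+ (if does (x ∈? Q) then g x else 0)
    pointwise x with x ∈? P | x ∈? Q | x ∈? P ∪ Q
    ... | yes x∈P | yes x∈Q | _        = ⊥-elim (disjoint x∈P x∈Q)
    ... | yes _   | no  _   | yes _    = sym (ℕ.+-identityʳ (g x))
    ... | no  _   | yes _   | yes _    = refl
    ... | no  _   | no  _   | no  _    = refl
    ... | yes x∈P | no  _   | no  x∉PQ = ⊥-elim (x∉PQ (x∈p∪q⁺ (inj₁ x∈P)))
    ... | no  _   | yes x∈Q | no  x∉PQ = ⊥-elim (x∉PQ (x∈p∪q⁺ (inj₂ x∈Q)))
    ... | no  x∉P | no  x∉Q | yes x∈PQ with x∈p∪q⁻ P Q x∈PQ
    ...   | inj₁ x∈P = ⊥-elim (x∉P x∈P)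
    ...   | inj₂ x∈Q = ⊥-elim (x∉Q x∈Q)

  ∈-prefix⁺ : ∀ (rk : Fin n → ℕ) S {x y} → y ∈ S → rk y ℕ.< rk x → y ∈ prefix rk S x
  ∈-prefix⁺ rk S {x} {y} y∈S rky<rkx = lookup⇒[]= y (prefix rk S x)
    (trans (lookup∘tabulate _ y) (cong₂ _∧_ (dec-true (y ∈? S) y∈S) (dec-true (rk y ℕ.<? rk x) rky<rkx)))

  ∈-prefix⁻ : ∀ (rk : Fin n → ℕ) S {x y} → y ∈ prefix rk S x → y ∈ S × rk y ℕ.< rk x
  ∈-prefix⁻ rk S {x} {y} y∈prefix =
    does-∧ (y ∈? S) (rk y ℕ.<? rk x) (trans (sym (lookup∘tabulate _ y)) ([]=⇒lookup y∈prefix))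
    where
    does-∧ : ∀ {A B : Set} (a? : Dec A) (b? : Dec B) → does a? ∧ does b? ≡ true → A × B
    does-∧ (yes a) (yes b) _ = a , b
    does-∧ (yes _) (no _)  ()
    does-∧ (no _)  _       ()

module LocalSearch (R : FloorField) where
  open FloorField R
  open OrderedField ordF renaming (+-mono-≤ to +-monoˡ-≤)
  open OrderedFieldProperties ordF
  open FloorProperties R
  open Setup R
  open RingProperties (CommutativeRing.ring commutativeRing) using (-0#≈0#)
  open IsCommutativeRing isCommutativeRing
    using (+-comm; +-identityˡ; +-identityʳ; *-comm; *-assoc; *-identityˡ; *-identityʳ; distribʳ; zeroˡ; zeroʳ)

  Σ-cong : ∀ {m} {g h : Fin m → Carrier} → (∀ i → g i ≡ h i) → Σ[ g ] ≡ Σ[ h ]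
  Σ-cong {zero}  g≡h = refl
  Σ-cong {suc m} g≡h = cong₂ _+_ (g≡h zero) (Σ-cong (λ i → g≡h (suc i)))

  Σ-mono-≤ : ∀ {m} {g h : Fin m → Carrier} → (∀ i → g i ≤ h i) → Σ[ g ] ≤ Σ[ h ]
  Σ-mono-≤ {zero}  g≤h = ≤-refl
  Σ-mono-≤ {suc m} g≤h = +-mono-≤ (g≤h zero) (Σ-mono-≤ (λ i → g≤h (suc i)))

  Σ-fromℕ-* : ∀ {m} (g : Fin m → ℕ) c → Σ[ (λ i → fromℕ (g i) * c) ] ≡ fromℕ (sum g) * c
  Σ-fromℕ-* {zero}  g c = sym (zeroˡ c)
  Σ-fromℕ-* {suc m} g c = begin
    fromℕ (g zero) * c + Σ[ (λ i → fromℕ (g (suc i)) * c) ] ≡⟨ cong (fromℕ (g zero) * c +_)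
                                                                    (Σ-fromℕ-* (λ i → g (suc i)) c) ⟩
    fromℕ (g zero) * c + fromℕ (sum (λ i → g (suc i))) * c ≡⟨ sym (distribʳ c _ _) ⟩
    (fromℕ (g zero) + fromℕ (sum (λ i → g (suc i)))) * c    ≡⟨ cong (_* c) (sym (fromℕ-+ (g zero) _)) ⟩
    fromℕ (sum g) * c                                       ∎
    where open ≡-Reasoning

  Σ-const : ∀ m c → Σ[ (λ (_ : Fin m) → c) ] ≡ fromℕ m * c
  Σ-const zero    c = sym (zeroˡ c)
  Σ-const (suc m) c = trans (cong₂ _+_ (sym (*-identityˡ c)) (Σ-const m c)) (sym (distribʳ c 1# (fromℕ m)))

  module _ {n : ℕ} where

    sumOver-fromℕ-* : ∀ S (g : Fin n → ℕ) c →
                      sumOver S (λ x → fromℕ (g x) * c) ≡ fromℕ (sumℕOver S g) * c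
    sumOver-fromℕ-* S g c = trans (Σ-cong pointwise) (Σ-fromℕ-* (indicator S g) c)
      where
      pointwise : ∀ x → (if does (x ∈? S) then fromℕ (g x) * c else 0#) ≡
                        fromℕ (if does (x ∈? S) then g x else 0) * c
      pointwise x with x ∈? S
      ... | yes _ = refl
      ... | no  _ = sym (zeroˡ c)

    sumOver-≤-const : ∀ S {g : Fin n → Carrier} {c} → 0# ≤ c → (∀ {x} → x ∈ S → g x ≤ c) →
                      sumOver S g ≤ fromℕ n * c
    sumOver-≤-const S {g} {c} 0≤c g≤c = subst (sumOver S g ≤_) (Σ-const n c) (Σ-mono-≤ pointwise)
      where
      pointwise : ∀ x → (if does (x ∈? S) then g x else 0#) ≤ c
      pointwise x with x ∈? S
      ... | yes x∈S = g≤c x∈S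
      ... | no  _   = 0≤c

    sumOver-zero : ∀ S {g : Fin n → Carrier} → (∀ x → g x ≡ 0#) → sumOver S g ≡ 0#
    sumOver-zero S {g} g≡0 = trans (Σ-cong pointwise) (trans (Σ-const n 0#) (zeroʳ (fromℕ n)))
      where
      pointwise : ∀ x → (if does (x ∈? S) then g x else 0#) ≡ 0#
      pointwise x with x ∈? S
      ... | yes _ = g≡0 x
      ... | no  _ = refl

    sumOver-cong : ∀ S {g h : Fin n → Carrier} → (∀ x → g x ≡ h x) → sumOver S g ≡ sumOver S h
    sumOver-cong S g≡h = Σ-cong (λ x → cong (if does (x ∈? S) then_else 0#) (g≡h x))

    sumOver-sq-fromℕ-* : ∀ S (g : Fin n → ℕ) c →
                         sumOver S (λ x → sq {n} (fromℕ (g x) * c)) ≡ fromℕ (sumℕOver S (square ∘ g)) * (c * c)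
    sumOver-sq-fromℕ-* S g c =
      trans (sumOver-cong S pointwise) (sumOver-fromℕ-* S (square ∘ g) (c * c))
      where
      pointwise : ∀ x → sq {n} (fromℕ (g x) * c) ≡ fromℕ (square (g x)) * (c * c)
      pointwise x = trans ([xy]²≡x²y² (fromℕ (g x)) c) (cong (_* (c * c)) (sym (fromℕ-* (g x) (g x))))

    marginal : (Subset n → Carrier) → Subset n → Fin n → Carrier
    marginal f P x = f (P ∪ ⁅ x ⁆) - f P

    marginal-nonneg : ∀ {f} → Monotone f → ∀ P x → 0# ≤ marginal f P x
    marginal-nonneg f-mono P x = x≤y⇒0≤y-x (f-mono P (P ∪ ⁅ x ⁆) (p⊆p∪q ⁅ x ⁆))

    marginal-antitone : ∀ {f} → Monotone f → Submodular f →
                        ∀ {P Q} x → P ⊆ Q → marginal f Q x ≤ marginal f P x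
    marginal-antitone {f} f-mono f-sub {P} {Q} x P⊆Q = x+y≤z+w⇒x-w≤z-y (begin
      f (Q ∪ ⁅ x ⁆) + f P                      ≤⟨ +-mono-≤ (f-mono _ _ Q∪x⊆) (f-mono _ _ P⊆) ⟩
      f ((P ∪ ⁅ x ⁆) ∪ Q) + f ((P ∪ ⁅ x ⁆) ∩ Q) ≤⟨ f-sub (P ∪ ⁅ x ⁆) Q ⟩
      f (P ∪ ⁅ x ⁆) + f Q                      ∎)
      where
      open ≤-Reasoning
      Q∪x⊆ : Q ∪ ⁅ x ⁆ ⊆ (P ∪ ⁅ x ⁆) ∪ Q
      Q∪x⊆ y∈ with x∈p∪q⁻ Q ⁅ x ⁆ y∈
      ... | inj₁ y∈Q = x∈p∪q⁺ (inj₂ y∈Q)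
      ... | inj₂ y∈x = x∈p∪q⁺ (inj₁ (x∈p∪q⁺ (inj₂ y∈x)))
      P⊆ : P ⊆ (P ∪ ⁅ x ⁆) ∩ Q
      P⊆ y∈P = x∈p∩q⁺ (p⊆p∪q ⁅ x ⁆ y∈P , P⊆Q y∈P)

    marginal≤singleton : ∀ {f} → NonNegative f → Submodular f → ∀ P x → marginal f P x ≤ f ⁅ x ⁆
    marginal≤singleton {f} f-nonneg f-sub P x = subst (marginal f P x ≤_) (x-0≡x (f ⁅ x ⁆))
      (x+y≤z+w⇒x-w≤z-y (begin
        f (P ∪ ⁅ x ⁆) + 0#                  ≤⟨ +-monoʳ-≤ _ (f-nonneg (P ∩ ⁅ x ⁆)) ⟩
        f (P ∪ ⁅ x ⁆) + f (P ∩ ⁅ x ⁆)       ≤⟨ f-sub P ⁅ x ⁆ ⟩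
        f P + f ⁅ x ⁆                       ≡⟨ +-comm (f P) (f ⁅ x ⁆) ⟩
        f ⁅ x ⁆ + f P                       ∎))
      where
      open ≤-Reasoning
      x-0≡x : ∀ x → x - 0# ≡ x
      x-0≡x x = trans (cong (x +_) -0#≈0#) (+-identityʳ x)

    <-reflect : ∀ {rk rk' : Fin n → ℕ} → Injective _≡_ _≡_ rk → ∀ {x y} →
                (rk x ℕ.< rk y → rk' x ℕ.< rk' y) → rk' y ℕ.< rk' x → rk y ℕ.< rk x
    <-reflect {rk} {rk'} rk-inj {x} {y} preserves rk'y<rk'x with ℕ.<-cmp (rk y) (rk x)
    ... | tri< rky<rkx _ _ = rky<rkx
    ... | tri≈ _ rky≡rkx _ = ⊥-elim (ℕ.<-irrefl (cong rk' (rk-inj rky≡rkx)) rk'y<rk'x)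
    ... | tri> _ _ rkx<rky = ⊥-elim (ℕ.<-asym rk'y<rk'x (preserves rkx<rky))

    prefix-reorder-kept : ∀ {rk rk' : Fin n → ℕ} {S A B x} → Injective _≡_ _≡_ rk → IsReorder rk rk' S A B →
                          x ∈ S ─ B → prefix rk' ((S ─ B) ∪ A) x ⊆ prefix rk S x
    prefix-reorder-kept {rk} {rk'} {S} {A} {B} {x} rk-inj (_ , kept<added , kept-mono , _) x∈S─B y∈prefix
      with ∈-prefix⁻ rk' _ y∈prefix
    ... | y∈S' , rk'y<rk'x with x∈p∪q⁻ (S ─ B) A y∈S'
    ...   | inj₁ y∈S─B = ∈-prefix⁺ rk S (p─q⊆p S B y∈S─B) (<-reflect rk-inj (kept-mono x _ x∈S─B y∈S─B) rk'y<rk'x)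
    ...   | inj₂ y∈A   = ⊥-elim (ℕ.<-asym rk'y<rk'x (kept<added x _ x∈S─B y∈A))

    prefix-reorder-added : ∀ {rk rk' : Fin n → ℕ} {S A B a} → Injective _≡_ _≡_ rk → IsReorder rk rk' S A B →
                           a ∈ A → prefix rk' ((S ─ B) ∪ A) a ⊆ (S ─ B) ∪ prefix rk A a
    prefix-reorder-added {rk} {rk'} {S} {A} {B} {a} rk-inj (_ , _ , _ , added-mono) a∈A y∈prefix
      with ∈-prefix⁻ rk' _ y∈prefix
    ... | y∈S' , rk'y<rk'a with x∈p∪q⁻ (S ─ B) A y∈S'
    ...   | inj₁ y∈S─B = x∈p∪q⁺ (inj₁ y∈S─B)
    ...   | inj₂ y∈A   = x∈p∪q⁺ (inj₂ (∈-prefix⁺ rk A y∈A (<-reflect rk-inj (added-mono a _ a∈A y∈A) rk'y<rk'a)))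

  module Potential {n : ℕ} (f : Subset n → Carrier) (f-mono : Monotone f) (f-sub : Submodular f)
                   (α : Carrier) (0≤α : 0# ≤ α) (α≢0 : α ≢ 0#) where

    level : Subset n → Fin n → ℕ
    level P x = floorℕ (marginal f P x * α ⁻¹)

    private
      0≤α⁻¹ : 0# ≤ α ⁻¹
      0≤α⁻¹ = ⁻¹-nonneg 0≤α α≢0

      0≤marginal/α : ∀ P x → 0# ≤ marginal f P x * α ⁻¹
      0≤marginal/α P x = *-nonneg (marginal-nonneg f-mono P x) 0≤α⁻¹

    quantize-marginal : ∀ P x → quantize {n} α (marginal f P x) ≡ fromℕ (level P x) * α
    quantize-marginal P x = cong (_* α) (⌊⌋≡floorℕ (0≤marginal/α P x))

    level-antitone : ∀ {P Q} x → P ⊆ Q → level Q x ℕ.≤ level P x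
    level-antitone x P⊆Q =
      floorℕ-mono-≤ (0≤marginal/α _ x) (*-monoˡ-≤ (α ⁻¹) 0≤α⁻¹ (marginal-antitone f-mono f-sub x P⊆Q))

    level*α≤marginal : ∀ P x → fromℕ (level P x) * α ≤ marginal f P x
    level*α≤marginal P x = begin
      fromℕ (level P x) * α        ≤⟨ *-monoˡ-≤ α 0≤α (floorℕ-≤ (0≤marginal/α P x)) ⟩
      marginal f P x * α ⁻¹ * α    ≡⟨ *-assoc _ (α ⁻¹) α ⟩
      marginal f P x * (α ⁻¹ * α)  ≡⟨ cong (marginal f P x *_) (trans (*-comm (α ⁻¹) α) (⁻¹-inverse α α≢0)) ⟩
      marginal f P x * 1#          ≡⟨ *-identityʳ _ ⟩
      marginal f P x               ∎
      where open ≤-Reasoning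

    sumOver-sq-quantize : ∀ S (P : Fin n → Subset n) →
      sumOver S (λ x → sq {n} (quantize {n} α (marginal f (P x) x))) ≡
      fromℕ (sumℕOver S (λ x → square (level (P x) x))) * (α * α)
    sumOver-sq-quantize S P =
      trans (sumOver-cong S (λ x → cong (sq {n}) (quantize-marginal (P x) x)))
            (sumOver-sq-fromℕ-* S (λ x → level (P x) x) α)

    potential : (Fin n → ℕ) → Subset n → ℕ
    potential rk S = sumℕOver S (λ x → square (level (prefix rk S x) x))

    potential-increases : ∀ {k I S rk S' rk'} → Injective _≡_ _≡_ rk →
                          Step k I f α (S , rk) (S' , rk') → potential rk S ℕ.< potential rk' S'
    potential-increases {S = S} {rk} {rk' = rk'} rk-inj
                        (A , B , (B⊆S , A⊆∁[S─B] , _) , improves , refl , reorder) = begin-strict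
      potential rk S                                       ≤⟨ sumℕOver-⊆-∪ (S ─ B) B old S⊆[S─B]∪B ⟩
      sumℕOver (S ─ B) old ℕ.+ sumℕOver B old              <⟨ ℕ.+-monoʳ-< (sumℕOver (S ─ B) old) gain ⟩
      sumℕOver (S ─ B) old ℕ.+ sumℕOver A exchanged        ≤⟨ ℕ.+-mono-≤ (sumℕOver-mono-≤ (S ─ B) kept)
                                                                          (sumℕOver-mono-≤ A added) ⟩
      sumℕOver (S ─ B) new ℕ.+ sumℕOver A new              ≡⟨ sumℕOver-∪ (S ─ B) A new disjoint ⟨
      potential rk' ((S ─ B) ∪ A)                          ∎
      where
      open ℕ.≤-Reasoning
      old exchanged new : Fin n → ℕ
      old       x = square (level (prefix rk S x) x)
      exchanged x = square (level ((S ─ B) ∪ prefix rk A x) x)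
      new       x = square (level (prefix rk' ((S ─ B) ∪ A) x) x)

      S⊆[S─B]∪B : S ⊆ (S ─ B) ∪ B
      S⊆[S─B]∪B {x} x∈S with x ∈? B
      ... | yes x∈B = x∈p∪q⁺ (inj₂ x∈B)
      ... | no  x∉B = x∈p∪q⁺ (inj₁ (x∈p∧x∉q⇒x∈p─q x∈S x∉B))

      disjoint : ∀ {x} → x ∈ S ─ B → x ∉ A
      disjoint x∈S─B x∈A = x∈∁p⇒x∉p (A⊆∁[S─B] x∈A) x∈S─B

      gain : sumℕOver B old ℕ.< sumℕOver A exchanged
      gain = fromℕ-*-cancelʳ-< (*-nonneg 0≤α 0≤α)
        (subst₂ _<_ (sumOver-sq-quantize B (prefix rk S))
                    (sumOver-sq-quantize A (λ a → (S ─ B) ∪ prefix rk A a)) improves)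

      kept : ∀ {x} → x ∈ S ─ B → old x ℕ.≤ new x
      kept {x} x∈S─B = square-mono-≤ (level-antitone x (prefix-reorder-kept rk-inj reorder x∈S─B))

      added : ∀ {a} → a ∈ A → exchanged a ℕ.≤ new a
      added {a} a∈A = square-mono-≤ (level-antitone a (prefix-reorder-added rk-inj reorder a∈A))

    potential-run : ∀ {k I t S rk S' rk'} → Injective _≡_ _≡_ rk →
                    Run k I f α t (S , rk) (S' , rk') → t ℕ.+ potential rk S ℕ.≤ potential rk' S'
    potential-run rk-inj done = ℕ.≤-refl
    potential-run {k} {I} {suc t} {S} {rk} rk-inj
                  (step {s' = S₁ , rk₁} improvement@(_ , _ , _ , _ , _ , rk₁-inj , _) run) = begin
      suc t ℕ.+ potential rk S    ≡⟨ ℕ.+-suc t (potential rk S) ⟨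
      t ℕ.+ suc (potential rk S)  ≤⟨ ℕ.+-monoʳ-≤ t (potential-increases {k} {I} rk-inj improvement) ⟩
      t ℕ.+ potential rk₁ S₁      ≤⟨ potential-run rk₁-inj run ⟩
      _                           ∎
      where open ℕ.≤-Reasoning

    potential-bound : NonNegative f → ∀ {M} → 0# ≤ M → (∀ x → f ⁅ x ⁆ ≤ M) →
                      ∀ rk S → fromℕ (potential rk S) * (α * α) ≤ fromℕ n * (M * M)
    potential-bound f-nonneg {M} 0≤M f⁅x⁆≤M rk S =
      subst (_≤ fromℕ n * (M * M)) (sumOver-sq-fromℕ-* S weightLevel α)
        (sumOver-≤-const S (*-nonneg 0≤M 0≤M) sq≤M²)
      where
      weightLevel : Fin n → ℕ
      weightLevel x = level (prefix rk S x) x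
      sq≤M² : ∀ {x} → x ∈ S → sq {n} (fromℕ (weightLevel x) * α) ≤ M * M
      sq≤M² {x} _ = *-self-mono-≤ (*-nonneg (fromℕ-nonneg (weightLevel x)) 0≤α) (begin
        fromℕ (weightLevel x) * α      ≤⟨ level*α≤marginal (prefix rk S x) x ⟩
        marginal f (prefix rk S x) x   ≤⟨ marginal≤singleton f-nonneg f-sub (prefix rk S x) x ⟩
        f ⁅ x ⁆                        ≤⟨ f⁅x⁆≤M x ⟩
        M                              ∎)
        where open ≤-Reasoning

    run-length-bound : NonNegative f → ∀ {M} → 0# ≤ M → (∀ x → f ⁅ x ⁆ ≤ M) →
                       ∀ {k I t S rk S' rk'} → Injective _≡_ _≡_ rk → Run k I f α t (S , rk) (S' , rk') →
                       fromℕ t * (α * α) ≤ fromℕ n * (M * M)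
    run-length-bound f-nonneg {M} 0≤M f⁅x⁆≤M {t = t} {S} {rk} {S'} {rk'} rk-inj run = begin
      fromℕ t * (α * α)                  ≤⟨ *-monoˡ-≤ (α * α) (*-nonneg 0≤α 0≤α) (fromℕ-mono-≤ t≤potential) ⟩
      fromℕ (potential rk' S') * (α * α) ≤⟨ potential-bound f-nonneg 0≤M f⁅x⁆≤M rk' S' ⟩
      fromℕ n * (M * M)                  ∎
      where
      open ≤-Reasoning
      t≤potential : t ℕ.≤ potential rk' S'
      t≤potential = ℕ.m+n≤o⇒m≤o t (potential-run rk-inj run)

  -- For α = 0 every quantized weight vanishes, so no exchange is an improvement.
  improvement⇒α≢0 : ∀ {n} k I (f : Subset n → Carrier) {α} {S S' : Subset n} {rk rk' : Fin n → ℕ} →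
                    Step k I f α (S , rk) (S' , rk') → α ≢ 0#
  improvement⇒α≢0 {n} _ _ _ (A , B , _ , (_ , sums≢) , _) refl =
    sums≢ (trans (sumOver-zero B (λ _ → sq0)) (sym (sumOver-zero A (λ _ → sq0))))
    where
    sq0 : ∀ {x} → sq {n} (x * 0#) ≡ 0#
    sq0 {x} = trans (cong (λ v → v * v) (zeroʳ x)) (zeroʳ 0#)

  module _ (k : ℕ) {n : ℕ} {f : Subset n → Carrier} (f-nonneg : NonNegative f) (e* : Fin n) {ε : Carrier}
           (0<ε : 0# < ε) (ε<1 : ε < 1#) where

    private
      -- D is the paper's δ⁻¹.
      F E K D N N³ α : Carrier
      F  = f ⁅ e* ⁆
      E  = fromℕ 2 * ε
      K  = fromℕ (k ℕ.+ 3)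
      D  = 1# + K * E ⁻¹
      N  = fromℕ n
      N³ = N * (N * N)
      α  = alpha k ε f e*

      0≤F : 0# ≤ F
      0≤F = f-nonneg ⁅ e* ⁆

      0≤ε : 0# ≤ ε
      0≤ε = proj₁ 0<ε

      0≤E : 0# ≤ E
      0≤E = *-nonneg (fromℕ-nonneg 2) 0≤ε

      E≢0 : E ≢ 0#
      E≢0 = *-≢0 (1≤x⇒x≢0 (1≤fromℕ-suc 1)) (λ ε≡0 → proj₂ 0<ε (sym ε≡0))

      1≤D : 1# ≤ D
      1≤D = subst (_≤ D) (+-identityʳ 1#) (+-monoʳ-≤ 1# (*-nonneg (fromℕ-nonneg (k ℕ.+ 3)) (⁻¹-nonneg 0≤E E≢0)))

      0≤D : 0# ≤ D
      0≤D = ≤-trans 0≤1 1≤D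

      D≢0 : D ≢ 0#
      D≢0 = 1≤x⇒x≢0 1≤D

      0≤N : 0# ≤ N
      0≤N = fromℕ-nonneg n

      N≢0 : N ≢ 0#
      N≢0 = fromℕ-≢0 e*

      0≤N³ : 0# ≤ N³
      0≤N³ = *-nonneg 0≤N (*-nonneg 0≤N 0≤N)

      0≤α : 0# ≤ α
      0≤α = *-nonneg (*-nonneg 0≤F (⁻¹-nonneg 0≤D D≢0)) (⁻¹-nonneg 0≤N N≢0)

    Dε≤k+5 : D * ε ≤ fromℕ (k ℕ.+ 5)
    Dε≤k+5 = begin
      D * ε          ≤⟨ *-monoʳ-≤ D 0≤D ε≤E ⟩
      D * E          ≡⟨ DE≡E+K ⟩
      E + K          ≤⟨ +-monoˡ-≤ K E≤2 ⟩
      fromℕ 2 + K    ≡⟨ fromℕ-+ 2 (k ℕ.+ 3) ⟨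
      fromℕ (2 ℕ.+ (k ℕ.+ 3)) ≡⟨ cong fromℕ (trans (cong (2 ℕ.+_) (ℕ.+-comm k 3)) (ℕ.+-comm 5 k)) ⟩
      fromℕ (k ℕ.+ 5) ∎
      where
      open ≤-Reasoning
      ε≤E : ε ≤ E
      ε≤E = subst (_≤ E) (*-identityˡ ε) (*-monoˡ-≤ ε 0≤ε (1≤fromℕ-suc 1))
      E≤2 : E ≤ fromℕ 2
      E≤2 = subst (E ≤_) (*-identityʳ (fromℕ 2)) (*-monoʳ-≤ (fromℕ 2) (fromℕ-nonneg 2) (proj₁ ε<1))
      DE≡E+K : D * E ≡ E + K
      DE≡E+K = begin-equality
        (1# + K * E ⁻¹) * E        ≡⟨ distribʳ E 1# (K * E ⁻¹) ⟩
        1# * E + K * E ⁻¹ * E      ≡⟨ cong₂ _+_ (*-identityˡ E) (*-assoc K (E ⁻¹) E) ⟩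
        E + K * (E ⁻¹ * E)         ≡⟨ cong (λ v → E + K * v) (trans (*-comm (E ⁻¹) E) (⁻¹-inverse E E≢0)) ⟩
        E + K * 1#                 ≡⟨ cong (E +_) (*-identityʳ K) ⟩
        E + K                      ∎

    α-bound⇒t≤N³D² : α ≢ 0# → ∀ t → fromℕ t * (α * α) ≤ N * (F * F) → fromℕ t ≤ N³ * (D * D)
    α-bound⇒t≤N³D² α≢0 t tα²≤NF² = subst (fromℕ t ≤_) NF²u²≡N³D²
      (x*a²≤y⇒x≤y*u² (*-nonneg (*-nonneg 0≤N 0≤D) (⁻¹-nonneg 0≤F F≢0)) αu≡1 tα²≤NF²)
      where
      open ≡-Reasoning
      open *-Solver using (solve; _⊕_; _⊜_)

      F≢0 : F ≢ 0#
      F≢0 F≡0 = α≢0 (begin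
        F * D ⁻¹ * N ⁻¹    ≡⟨ cong (λ v → v * D ⁻¹ * N ⁻¹) F≡0 ⟩
        0# * D ⁻¹ * N ⁻¹   ≡⟨ cong (_* N ⁻¹) (zeroˡ (D ⁻¹)) ⟩
        0# * N ⁻¹          ≡⟨ zeroˡ (N ⁻¹) ⟩
        0#                 ∎)

      u : Carrier
      u = N * D * F ⁻¹

      αu≡1 : α * u ≡ 1#
      αu≡1 = begin
        F * D ⁻¹ * N ⁻¹ * (N * D * F ⁻¹)       ≡⟨ regroup F D N (F ⁻¹) (D ⁻¹) (N ⁻¹) ⟩
        (F * F ⁻¹) * ((D * D ⁻¹) * (N * N ⁻¹)) ≡⟨ cong₂ _*_ (⁻¹-inverse F F≢0)
                                                    (cong₂ _*_ (⁻¹-inverse D D≢0) (⁻¹-inverse N N≢0)) ⟩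
        1# * (1# * 1#)                         ≡⟨ trans (*-identityˡ _) (*-identityˡ 1#) ⟩
        1#                                     ∎
        where
        regroup : ∀ F D N F' D' N' → F * D' * N' * (N * D * F') ≡ (F * F') * ((D * D') * (N * N'))
        regroup = solve 6 (λ F D N F' D' N' →
          ((F ⊕ D') ⊕ N') ⊕ ((N ⊕ D) ⊕ F') ⊜ (F ⊕ F') ⊕ ((D ⊕ D') ⊕ (N ⊕ N'))) refl

      NF²u²≡N³D² : N * (F * F) * (u * u) ≡ N³ * (D * D)
      NF²u²≡N³D² = begin
        N * (F * F) * (u * u)                     ≡⟨ regroup N F D (F ⁻¹) ⟩
        (F * F ⁻¹) * (F * F ⁻¹) * (N³ * (D * D)) ≡⟨ cong (λ v → v * v * (N³ * (D * D))) (⁻¹-inverse F F≢0) ⟩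
        1# * 1# * (N³ * (D * D))                  ≡⟨ trans (cong (_* (N³ * (D * D))) (*-identityˡ 1#)) (*-identityˡ _) ⟩
        N³ * (D * D)                              ∎
        where
        regroup : ∀ N F D F' →
                  N * (F * F) * ((N * D * F') * (N * D * F')) ≡ (F * F') * (F * F') * (N * (N * N) * (D * D))
        regroup = solve 4 (λ N F D F' →
          (N ⊕ (F ⊕ F)) ⊕ (((N ⊕ D) ⊕ F') ⊕ ((N ⊕ D) ⊕ F'))
            ⊜ ((F ⊕ F') ⊕ (F ⊕ F')) ⊕ ((N ⊕ (N ⊕ N)) ⊕ (D ⊕ D))) refl

    α-bound⇒ε-bound : α ≢ 0# → ∀ t → fromℕ t * (α * α) ≤ N * (F * F) →
                      fromℕ t * (ε * ε) ≤ fromℕ ((k ℕ.+ 5) ℕ.* (k ℕ.+ 5) ℕ.* n ℕ.^ 3)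
    α-bound⇒ε-bound α≢0 t tα²≤NF² = begin
      fromℕ t * (ε * ε)                       ≤⟨ *-monoˡ-≤ (ε * ε) (*-nonneg 0≤ε 0≤ε) (α-bound⇒t≤N³D² α≢0 t tα²≤NF²) ⟩
      N³ * (D * D) * (ε * ε)                  ≡⟨ regroup N³ D ε ⟩
      N³ * ((D * ε) * (D * ε))                ≤⟨ *-monoʳ-≤ N³ 0≤N³ (*-self-mono-≤ (*-nonneg 0≤D 0≤ε) Dε≤k+5) ⟩
      N³ * (fromℕ (k ℕ.+ 5) * fromℕ (k ℕ.+ 5)) ≡⟨ fromℕ[c²n³] ⟨
      fromℕ ((k ℕ.+ 5) ℕ.* (k ℕ.+ 5) ℕ.* n ℕ.^ 3) ∎
      where
      open ≤-Reasoning
      regroup : ∀ Q D ε → Q * (D * D) * (ε * ε) ≡ Q * ((D * ε) * (D * ε))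
      regroup = solve 3 (λ Q D ε → (Q ⊕ (D ⊕ D)) ⊕ (ε ⊕ ε) ⊜ Q ⊕ ((D ⊕ ε) ⊕ (D ⊕ ε))) refl
        where open *-Solver
      fromℕ[c²n³] : fromℕ ((k ℕ.+ 5) ℕ.* (k ℕ.+ 5) ℕ.* n ℕ.^ 3) ≡ N³ * (fromℕ (k ℕ.+ 5) * fromℕ (k ℕ.+ 5))
      fromℕ[c²n³] = begin-equality
        fromℕ ((k ℕ.+ 5) ℕ.* (k ℕ.+ 5) ℕ.* n ℕ.^ 3)        ≡⟨ fromℕ-* ((k ℕ.+ 5) ℕ.* (k ℕ.+ 5)) (n ℕ.^ 3) ⟩
        fromℕ ((k ℕ.+ 5) ℕ.* (k ℕ.+ 5)) * fromℕ (n ℕ.^ 3)  ≡⟨ cong₂ _*_ (fromℕ-* (k ℕ.+ 5) (k ℕ.+ 5)) fromℕ[n³] ⟩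
        fromℕ (k ℕ.+ 5) * fromℕ (k ℕ.+ 5) * N³             ≡⟨ *-comm _ N³ ⟩
        N³ * (fromℕ (k ℕ.+ 5) * fromℕ (k ℕ.+ 5))           ∎
        where
        fromℕ[n³] : fromℕ (n ℕ.^ 3) ≡ N³
        fromℕ[n³] = trans (fromℕ-* n (n ℕ.* (n ℕ.* 1)))
          (cong (N *_) (trans (fromℕ-* n (n ℕ.* 1)) (cong (N *_) (cong fromℕ (ℕ.*-identityʳ n)))))

    iterations-bound : Monotone f → Submodular f → (∀ e → f ⁅ e ⁆ ≤ F) →
                       ∀ {I rk₀ t S rk} → Injective _≡_ _≡_ rk₀ → Run k I f α t (⁅ e* ⁆ , rk₀) (S , rk) →
                       fromℕ t * (ε * ε) ≤ fromℕ ((k ℕ.+ 5) ℕ.* (k ℕ.+ 5) ℕ.* n ℕ.^ 3)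
    iterations-bound _ _ _ _ done =
      subst (_≤ fromℕ ((k ℕ.+ 5) ℕ.* (k ℕ.+ 5) ℕ.* n ℕ.^ 3)) (sym (zeroˡ (ε * ε)))
        (fromℕ-nonneg ((k ℕ.+ 5) ℕ.* (k ℕ.+ 5) ℕ.* n ℕ.^ 3))
    iterations-bound f-mono f-sub f≤F {I} {t = t} rk₀-inj run@(step improvement _) =
      α-bound⇒ε-bound α≢0 t (run-length-bound f-nonneg 0≤F f≤F rk₀-inj run)
      where
      α≢0 : α ≢ 0#
      α≢0 = improvement⇒α≢0 k I f improvement
      open Potential f f-mono f-sub α 0≤α α≢0

theorem6 : (k : ℕ) → 1 ℕ.≤ k →
    ∃ λ (C : ℕ) →
      (R : FloorField) →
      let open FloorField R in
      let open OrderedField ordF in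
      let open Setup R in
      (n : ℕ) (I : Subset n → Set) →
      IsIndependenceSystem I → IsKExchange k I →
      (f : Subset n → Carrier) → NonNegative f → Monotone f → Submodular f →
      (ε : Carrier) → 0# < ε → ε < 1# →
      (e* : Fin n) → (∀ e → f ⁅ e ⁆ ≤ f ⁅ e* ⁆) →
      (rk₀ : Fin n → ℕ) → Injective _≡_ _≡_ rk₀ →
      (t : ℕ) (S : Subset n) (rk : Fin n → ℕ) →
      Run k I f (alpha k ε f e*) t (⁅ e* ⁆ , rk₀) (S , rk) →
      fromℕ t * (ε * ε) ≤ fromℕ (C ℕ.* n ℕ.^ 3)
theorem6 k _ = (k ℕ.+ 5) ℕ.* (k ℕ.+ 5) ,
  λ R _ _ _ _ _ f-nonneg f-mono f-sub _ 0<ε ε<1 e* e*-max _ rk₀-inj _ _ _ →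
    LocalSearch.iterations-bound R k f-nonneg e* 0<ε ε<1 f-mono f-sub e*-max rk₀-inj
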